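{- Let $m>1$, and let $C\in H(n,m)$. For $i\in\{1,2,3\}$, if the operation $\tau_i$ applies to $C$ and $\tau_i(C)$ is nonempty, then $\tau_i(C)\in H(N,m)$ for some integer $N$.
   Context: For a positive integer $N$ and $m>1$, the max $m$-power $x_m(N)$ is the largest power of $m$ dividing $N$ (i.e. $x_m(N)=m^s$ where $N=u m^s$, $m\nmid u$). $H(n,m)$ is the set of compositions $C=(c_1,\dots,c_k)$ of $n$ such that the values $x_m(c_1),\dots,x_m(c_k)$ are pairwise distinct and the sequence $(x_m(c_1),\dots,x_m(c_k))$ is unimodal (first increasing, then decreasing). The operations on a composition $C=(c_1,\dots,c_k)$ are: $\tau_1$: if the first (resp. last) part of $C$ is less than $m$, delete it, giving $(c_2,\dots,c_k)$ (resp. $(c_1,\dots,c_{k-1})$); $\tau_2$: if some part $c_t$ satisfies $c_t>m$ and $m\nmid c_t$, replace $c_t$ by $c_t-m$; $\tau_3$: if every part of $C$ is a multiple of $m$, replace $C$ by $(c_1/m,\dots,c_k/m)$. -}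

module Defs where

open import Data.Nat using (ℕ; zero; suc; _+_; _*_; _∸_; _^_; _≤_; _<_; NonZero)
open import Data.Nat.Divisibility using (_∣_; _∣?_; divides)
open import Data.Nat.DivMod using (_/_)
open import Data.List using (List; []; _∷_; _++_; map; [_])
open import Data.Nat.ListAction using (sum)
open import Data.List.Relation.Unary.All using (All)
open import Data.List.Relation.Unary.Linked using (Linked)
open import Data.List.Relation.Unary.Unique.Propositional using (Unique)
open import Data.Product using (Σ; ∃; ∃₂; _×_)
open import Relation.Binary.PropositionalEquality using (_≡_)
open import Relation.Nullary using (¬_; yes; no)

-- exponent of m in N, computed with fuel (fuel N suffices when m > 1, N > 0):
-- repeatedly divide by m while m divides the current value.
mexpAux : ℕ → ℕ → ℕ → ℕ
mexpAux zero    m N = 0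
mexpAux (suc f) m zero = 0
mexpAux (suc f) m (suc N) with m ∣? suc N
... | yes (divides q _) = suc (mexpAux f m q)
... | no _ = 0

mexp : ℕ → ℕ → ℕ
mexp m N = mexpAux N m N

xm : ℕ → ℕ → ℕ
xm m N = m ^ mexp m N

Unimodal : List ℕ → Set
Unimodal xs = ∃₂ λ as bs → xs ≡ as ++ bs × Linked _<_ as × Linked (λ a b → b < a) bs

H : ℕ → ℕ → List ℕ → Set
H n m C = All (λ c → 0 < c) C × sum C ≡ n
        × Unique (map (xm m) C) × Unimodal (map (xm m) C)

data Op (m : ℕ) : ℕ → List ℕ → List ℕ → Set where
  τ1-first : ∀ {c cs} → c < m → Op m 1 (c ∷ cs) cs
  τ1-last  : ∀ {c cs} → c < m → Op m 1 (cs ++ [ c ]) cs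
  τ2       : ∀ {cs c ds} → m < c → ¬ (m ∣ c) →
             Op m 2 (cs ++ c ∷ ds) (cs ++ (c ∸ m) ∷ ds)
  τ3       : ∀ {cs} {{_ : NonZero m}} → All (m ∣_) cs →
             Op m 3 cs (map (λ c → c / m) cs)

-- Deleting an end part keeps a composition in H because distinctness and
-- unimodality pass to prefixes and suffixes. The other two operations do not
-- change the shape of the sequence of max m-powers: a part c with m ∤ c has
-- x_m(c) = 1 = x_m(c - m), and dividing every part by m divides every x_m by m.
module Submission where

open import Defs
open import Data.Nat using (ℕ; zero; suc; _*_; _∸_; _^_; _≤_; _<_; z<s; s≤s; NonZero)
open import Data.Nat.Properties
  using (≤-refl; ≤-trans; ≤-pred; <⇒≤; m<m*n; m<n⇒0<n∸m; *-cancelˡ-<)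
open import Data.Nat.Divisibility using (_∣_; _∣?_; divides; ∣⇒≤; ∣m∸n∣n⇒∣m; ∣-refl)
open import Data.Nat.DivMod using (_/_; m*n/n≡m; m≥n⇒m/n>0)
open import Data.Nat.ListAction using (sum)
open import Data.List using (List; []; _∷_; _++_; map; [_])
open import Data.List.Properties using (map-++; map-id; ∷-injective; ++-identityʳ)
open import Data.List.Relation.Unary.All using (All; []; _∷_)
import Data.List.Relation.Unary.All.Properties as All
open import Data.List.Relation.Unary.AllPairs using (AllPairs; []; _∷_)
open import Data.List.Relation.Unary.Linked as Linked using (Linked; []; [-]; _∷_)
import Data.List.Relation.Unary.Linked.Properties as Linked
open import Data.List.Relation.Unary.Unique.Propositional using (Unique)
import Data.List.Relation.Unary.Unique.Propositional.Properties as Unique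
open import Data.Product using (∃; ∃₂; _×_; _,_)
open import Data.Sum using (_⊎_; inj₁; inj₂)
open import Data.Empty using (⊥-elim)
open import Function using (id)
open import Relation.Binary.PropositionalEquality
  using (_≡_; _≢_; refl; sym; trans; cong; cong₂; subst)
open import Relation.Nullary using (¬_; yes; no)

private
  variable
    R : ℕ → ℕ → Set

Linked-++⁻ˡ : ∀ xs {ys} → Linked R (xs ++ ys) → Linked R xs
Linked-++⁻ˡ []           _         = []
Linked-++⁻ˡ (x ∷ [])     _         = [-]
Linked-++⁻ˡ (x ∷ y ∷ xs) (r ∷ rxs) = r ∷ Linked-++⁻ˡ (y ∷ xs) rxs

Linked-++⁻ʳ : ∀ xs {ys} → Linked R (xs ++ ys) → Linked R ys
Linked-++⁻ʳ []       rys = rys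
Linked-++⁻ʳ (x ∷ xs) rxs = Linked-++⁻ʳ xs (Linked.tail rxs)

AllPairs-++⁻ˡ : ∀ xs {ys} → AllPairs R (xs ++ ys) → AllPairs R xs
AllPairs-++⁻ˡ []       _          = []
AllPairs-++⁻ˡ (x ∷ xs) (rx ∷ rxs) = All.++⁻ˡ xs rx ∷ AllPairs-++⁻ˡ xs rxs

AllPairs-++⁻ʳ : ∀ xs {ys} → AllPairs R (xs ++ ys) → AllPairs R ys
AllPairs-++⁻ʳ []       rys       = rys
AllPairs-++⁻ʳ (x ∷ xs) (_ ∷ rxs) = AllPairs-++⁻ʳ xs rxs

++-≡-++ : ∀ {A : Set} (xs ys as bs : List A) → xs ++ ys ≡ as ++ bs →
  (∃ λ r → as ≡ xs ++ r × ys ≡ r ++ bs) ⊎ (∃ λ r → xs ≡ as ++ r × bs ≡ r ++ ys)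
++-≡-++ []       ys as       bs e = inj₁ (as , refl , e)
++-≡-++ (x ∷ xs) ys []       bs e = inj₂ (x ∷ xs , refl , sym e)
++-≡-++ (x ∷ xs) ys (a ∷ as) bs e with ∷-injective e
... | refl , e′ with ++-≡-++ xs ys as bs e′
... | inj₁ (r , p , q) = inj₁ (r , cong (x ∷_) p , q)
... | inj₂ (r , p , q) = inj₂ (r , cong (x ∷_) p , q)

map-≡-++ : ∀ {A : Set} (f : A → ℕ) xs as bs → map f xs ≡ as ++ bs →
  ∃₂ λ as′ bs′ → xs ≡ as′ ++ bs′ × map f as′ ≡ as × map f bs′ ≡ bs
map-≡-++ f xs       []       bs e = [] , xs , refl , refl , e
map-≡-++ f []       (a ∷ as) bs ()
map-≡-++ f (x ∷ xs) (a ∷ as) bs e with ∷-injective e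
... | refl , e′ with map-≡-++ f xs as bs e′
... | as′ , bs′ , p , q , r = x ∷ as′ , bs′ , cong (x ∷_) p , cong (f x ∷_) q , r

Unimodal-++⁻ˡ : ∀ xs {ys} → Unimodal (xs ++ ys) → Unimodal xs
Unimodal-++⁻ˡ xs {ys} (as , bs , e , inc , dec) with ++-≡-++ xs ys as bs e
... | inj₁ (r , refl , _) = xs , [] , sym (++-identityʳ xs) , Linked-++⁻ˡ xs inc , []
... | inj₂ (r , p , refl) = as , r , p , inc , Linked-++⁻ˡ r dec

Unimodal-++⁻ʳ : ∀ xs {ys} → Unimodal (xs ++ ys) → Unimodal ys
Unimodal-++⁻ʳ xs {ys} (as , bs , e , inc , dec) with ++-≡-++ xs ys as bs e
... | inj₁ (r , refl , q) = r , bs , q , Linked-++⁻ʳ xs inc , dec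
... | inj₂ (r , refl , refl) = [] , ys , refl , [] , Linked-++⁻ʳ r dec

Unimodal-map⁻ : ∀ {f : ℕ → ℕ} → (∀ {a b} → f a < f b → a < b) →
  ∀ xs → Unimodal (map f xs) → Unimodal xs
Unimodal-map⁻ {f} f-reflects-< xs (as , bs , e , inc , dec) with map-≡-++ f xs as bs e
... | as′ , bs′ , p , refl , refl =
  as′ , bs′ , p , Linked.map f-reflects-< (Linked.map⁻ inc)
                , Linked.map f-reflects-< (Linked.map⁻ dec)

quotient<dividend : ∀ {m n q} → 1 < m → suc n ≡ q * m → q < suc n
quotient<dividend {q = zero}  _   _ = z<s
quotient<dividend {m} {q = suc q} 1<m e = subst (suc q <_) (sym e) (m<m*n (suc q) m 1<m)

mexpAux-fuel-irrelevant : ∀ {m} f g n → n ≤ f → n ≤ g → 1 < m →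
  mexpAux f m n ≡ mexpAux g m n
mexpAux-fuel-irrelevant zero    zero    n       _       _       _ = refl
mexpAux-fuel-irrelevant zero    (suc g) zero    _       _       _ = refl
mexpAux-fuel-irrelevant (suc f) zero    zero    _       _       _ = refl
mexpAux-fuel-irrelevant (suc f) (suc g) zero    _       _       _ = refl
mexpAux-fuel-irrelevant {m} (suc f) (suc g) (suc n) (s≤s n≤f) (s≤s n≤g) 1<m with m ∣? suc n
... | no _ = refl
... | yes (divides q eq) = cong suc
  (mexpAux-fuel-irrelevant f g q (≤-trans q≤n n≤f) (≤-trans q≤n n≤g) 1<m)
  where q≤n = ≤-pred (quotient<dividend 1<m eq)

mexp-∤ : ∀ {m c} → ¬ (m ∣ c) → mexp m c ≡ 0
mexp-∤ {c = zero} _ = refl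
mexp-∤ {m} {suc c} m∤c with m ∣? suc c
... | no _ = refl
... | yes m∣c = ⊥-elim (m∤c m∣c)

mexp-∣ : ∀ {m c} {{_ : NonZero m}} → 1 < m → m ∣ suc c →
  mexp m (suc c) ≡ suc (mexp m (suc c / m))
mexp-∣ {m} {c} 1<m m∣c with m ∣? suc c
... | no m∤c = ⊥-elim (m∤c m∣c)
... | yes (divides q eq) = cong suc (trans
  (mexpAux-fuel-irrelevant c q q (≤-pred (quotient<dividend 1<m eq)) ≤-refl 1<m)
  (cong (λ k → mexpAux k m k) q≡c/m))
  where
  q≡c/m : q ≡ suc c / m
  q≡c/m = sym (trans (cong (_/ m) eq) (m*n/n≡m q m))

xm-∤ : ∀ {m c} → ¬ (m ∣ c) → xm m c ≡ 1
xm-∤ {m} m∤c = cong (m ^_) (mexp-∤ m∤c)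

xm-∣ : ∀ {m c} {{_ : NonZero m}} → 1 < m → 0 < c → m ∣ c → xm m c ≡ m * xm m (c / m)
xm-∣ {m} {suc c} 1<m _ m∣c = cong (m ^_) (mexp-∣ 1<m m∣c)

xm-∸ : ∀ {m c} → m < c → ¬ (m ∣ c) → xm m (c ∸ m) ≡ xm m c
xm-∸ {m} {c} m<c m∤c = trans (xm-∤ m∤c-m) (sym (xm-∤ m∤c))
  where
  m∤c-m : ¬ (m ∣ c ∸ m)
  m∤c-m m∣c-m = m∤c (∣m∸n∣n⇒∣m m (<⇒≤ m<c) m∣c-m ∣-refl)

map-xm-/ : ∀ {m} {{_ : NonZero m}} → 1 < m → ∀ {cs} → All (0 <_) cs → All (m ∣_) cs →
  map (xm m) cs ≡ map (m *_) (map (xm m) (map (_/ m) cs))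
map-xm-/ 1<m []       []       = refl
map-xm-/ 1<m (p ∷ ps) (d ∷ ds) = cong₂ _∷_ (xm-∣ 1<m p d) (map-xm-/ 1<m ps ds)

All-/-positive : ∀ {m} {{_ : NonZero m}} {cs} → All (0 <_) cs → All (m ∣_) cs →
  All (0 <_) (map (_/ m) cs)
All-/-positive []                      []       = []
All-/-positive (p@(s≤s _) ∷ ps) (d ∷ ds) = m≥n⇒m/n>0 (∣⇒≤ d) ∷ All-/-positive ps ds

All-++-∷-replace : ∀ {P : ℕ → Set} cs {x y ds} → All P (cs ++ x ∷ ds) → P y →
  All P (cs ++ y ∷ ds)
All-++-∷-replace cs pcs++x∷ds py with All.++⁻ cs pcs++x∷ds
... | pcs , _ ∷ pds = All.++⁺ pcs (py ∷ pds)

map-++-∷-cong : ∀ (f : ℕ → ℕ) cs {x y ds} → f x ≡ f y →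
  map f (cs ++ x ∷ ds) ≡ map f (cs ++ y ∷ ds)
map-++-∷-cong f [] {ds = ds} e = cong (_∷ map f ds) e
map-++-∷-cong f (c ∷ cs) e = cong (f c ∷_) (map-++-∷-cong f cs e)

H-++⁻ˡ : ∀ {n m} C {D} → H n m (C ++ D) → H (sum C) m C
H-++⁻ˡ {m = m} C {D} (pos , _ , uniq , uni) =
  All.++⁻ˡ C pos , refl ,
  AllPairs-++⁻ˡ (map (xm m) C) (subst Unique (map-++ (xm m) C D) uniq) ,
  Unimodal-++⁻ˡ (map (xm m) C) (subst Unimodal (map-++ (xm m) C D) uni)

H-++⁻ʳ : ∀ {n m} C {D} → H n m (C ++ D) → H (sum D) m D
H-++⁻ʳ {m = m} C {D} (pos , _ , uniq , uni) =
  All.++⁻ʳ C pos , refl ,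
  AllPairs-++⁻ʳ (map (xm m) C) (subst Unique (map-++ (xm m) C D) uniq) ,
  Unimodal-++⁻ʳ (map (xm m) C) (subst Unimodal (map-++ (xm m) C D) uni)

H-map⁻ : ∀ {n m C D} (f : ℕ → ℕ) → (∀ {a b} → f a < f b → a < b) →
  All (0 <_) D → map (xm m) C ≡ map f (map (xm m) D) → H n m C → H (sum D) m D
H-map⁻ f f-reflects-< pos e (_ , _ , uniq , uni) =
  pos , refl , Unique.map⁻ (subst Unique e uniq) ,
  Unimodal-map⁻ f-reflects-< _ (subst Unimodal e uni)

lemma3p3 : (m n i : ℕ) (C C' : List ℕ) → 1 < m → H n m C →
    Op m i C C' → C' ≢ [] → ∃ λ N → H N m C'
lemma3p3 m n .1 .(_ ∷ C') C' _ hC (τ1-first _) _ = _ , H-++⁻ʳ [ _ ] hC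
lemma3p3 m n .1 .(C' ++ [ _ ]) C' _ hC (τ1-last _) _ = _ , H-++⁻ˡ C' hC
lemma3p3 m n .2 _ _ _ hC@(pos , _) (τ2 {cs} {c} {ds} m<c m∤c) _ =
  _ , H-map⁻ id id (All-++-∷-replace cs pos (m<n⇒0<n∸m m<c))
             (trans (map-++-∷-cong (xm m) cs (sym (xm-∸ m<c m∤c))) (sym (map-id _))) hC
lemma3p3 m n .3 C _ 1<m hC@(pos , _) (τ3 m∣C) _ =
  _ , H-map⁻ (m *_) (*-cancelˡ-< m _ _) (All-/-positive pos m∣C) (map-xm-/ 1<m pos m∣C) hC
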